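{- Let $k\ge 0$ be an integer and $n=48k+14$; all arithmetic is modulo $n$. Define $c_1(r)=r$ for $0\le r\le n-1$. Define $c_2,c_3:\{0,\dots,n-1\}\to\mathbb{Z}_n$ by: for $0\le i\le 12k+3$, $c_2(2i)=6k+1+i(12k+4)$ and $c_3(2i)=6k+2+i(12k+5)$; for $0\le i\le 12k+2$, $c_2(2i+1)=12k+3+i(12k+4)$ and $c_3(2i+1)=24k+8+i(12k+5)$; and for $0\le r\le 24k+6$ and $\alpha=2,3$, $c_\alpha(n-1-r)=n-1-c_\alpha(r)$. For $\alpha=1,2,3$ let ${\cal L}_\alpha=[l_\alpha(r,j)]$ be the $n\times n$ array with $l_\alpha(r,j)\equiv c_\alpha(r)+j\pmod n$, $0\le r,j\le n-1$. Then ${\cal L}_1,{\cal L}_2,{\cal L}_3$ are three (cyclic) mutually nearly orthogonal Latin squares of order $n$, i.e. they are Latin squares and each pair of them is nearly orthogonal.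
   Context: A Latin square of order $n$ is an $n\times n$ array in which each row and each column contains each of the symbols $0,\dots,n-1$ exactly once. For Latin squares $L=[l(i,j)]$ and $M=[m(i,j)]$ of even order $n$ on symbols $\{0,\dots,n-1\}$, their superimposition is the $n\times n$ array $A=[(l(i,j),m(i,j))]$. $L$ and $M$ are nearly orthogonal if in $A$ every ordered pair $(x,y)$ with $0\le x,y\le n-1$, $x\ne y$, occurs at least once, and each ordered pair $(x,x+n/2)$ (second coordinate taken modulo $n$) occurs exactly twice. A set of Latin squares is mutually nearly orthogonal if every two of them are nearly orthogonal. -}

module Defs where

open import Data.Nat using (ℕ; zero; suc; _+_; _*_; _∸_; _<?_; NonZero)
import Data.Nat
open import Data.Nat.DivMod using (_%_; _/_; m%n<n)
open import Data.Fin using (Fin; toℕ; fromℕ<)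
open import Data.Fin.Properties using (_≟_)
open import Data.List using (List; length; filter; cartesianProduct; allFin)
open import Data.Product using (_×_; _,_; ∃; ∃-syntax; ∃!)
open import Relation.Nullary using (¬_; yes; no)
open import Relation.Nullary.Decidable using (_×-dec_)
open import Relation.Binary.PropositionalEquality using (_≡_; _≢_)

Array : ℕ → Set
Array n = Fin n → Fin n → Fin n

IsLatinSquare : (n : ℕ) → Array n → Set
IsLatinSquare n L =
  (∀ (r : Fin n) (x : Fin n) → ∃! _≡_ (λ j → L r j ≡ x)) ×
  (∀ (j : Fin n) (x : Fin n) → ∃! _≡_ (λ r → L r j ≡ x))

pairCount : (n : ℕ) → Array n → Array n → Fin n → Fin n → ℕ
pairCount n L M x y =
  length (filter (λ { (i , j) → (L i j ≟ x) ×-dec (M i j ≟ y) })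
                 (cartesianProduct (allFin n) (allFin n)))

shiftHalf : (n : ℕ) → .{{_ : NonZero n}} → Fin n → Fin n
shiftHalf n x = fromℕ< (m%n<n (toℕ x + n / 2) n)

NearlyOrthogonal : (n : ℕ) → .{{_ : NonZero n}} → Array n → Array n → Set
NearlyOrthogonal n L M =
  (∀ (x y : Fin n) → x ≢ y → ∃[ i ] ∃[ j ] (L i j ≡ x × M i j ≡ y)) ×
  (∀ (x : Fin n) → pairCount n L M x (shiftHalf n x) ≡ 2)

-- the order n = 48k+14 (written 14 + 48k so that it is visibly nonzero)
ord : ℕ → ℕ
ord k = 14 + 48 * k

lowerVal : (a b d r : ℕ) → ℕ
lowerVal a b d r with Data.Nat._≟_ (r % 2) 0
... | yes _ = a + (r / 2) * d
... | no _  = b + (r / 2) * d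

cGen : (k a b d : ℕ) → ℕ → ℕ
cGen k a b d r with r <? 24 * k + 7
... | yes _ = lowerVal a b d r % ord k
... | no _  = (ord k ∸ 1) ∸ (lowerVal a b d ((ord k ∸ 1) ∸ r) % ord k)

c₁ c₂ c₃ : ℕ → ℕ → ℕ
c₁ k r = r
c₂ k = cGen k (6 * k + 1) (12 * k + 3) (12 * k + 4)
c₃ k = cGen k (6 * k + 2) (24 * k + 8) (12 * k + 5)

cyclicSquare : (k : ℕ) → (ℕ → ℕ) → Array (ord k)
cyclicSquare k c r j = fromℕ< (m%n<n (c (toℕ r) + toℕ j) (ord k))

L₁ L₂ L₃ : (k : ℕ) → Array (ord k)
L₁ k = cyclicSquare k (c₁ k)
L₂ k = cyclicSquare k (c₂ k)
L₃ k = cyclicSquare k (c₃ k)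

module Submission where

-- Row r of the cyclic square of c is c(r), c(r) + 1, … in ℤ_n, so the square is Latin iff c is
-- injective mod n, and in the superimposition of the squares of cα and cβ the pair (x, y) sits in
-- row r (exactly once) iff d(r) = cβ(r) − cα(r) ≡ y − x.  So the squares are nearly orthogonal as
-- soon as d misses 0, takes the value n/2 = M twice and every other residue once.  Since c(n − 1 − r) =
-- n − 1 − c(r), d is odd under r ↦ n − 1 − r, so only the lower half r < M matters; there each of
-- the three differences is w·f(r) with w a unit mod n, w·M ≡ M, and f a bijection from
-- {0, …, M − 1} onto {1, …, M}.  As ±{1, …, M} covers the nonzero residues with the single overlap
-- M ≡ −M, this is exactly what is needed.

open import Defs
open import Level using (0ℓ)
open import Data.Nat as ℕ using (ℕ; zero; suc; z≤n; s≤s; _<_; _≤_; _∸_)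
import Data.Nat.Properties as ℕ
import Data.Nat.Divisibility as ℕ
open import Data.Nat.DivMod using (m%n<n; m*n/n≡m; m*n%n≡0; [m+kn]%n≡m%n; +-distrib-/-∣ʳ)
open import Data.Nat.Tactic.RingSolver renaming (solve-∀ to ℕ-solve-∀)
open import Data.Integer as ℤ using (ℤ; +_; _+_; _*_; _-_; -_; 0ℤ; 1ℤ; -1ℤ)
import Data.Integer.Properties as ℤ
open import Data.Integer.DivMod using (a≡a%ℕn+[a/ℕn]*n; n%ℕd<d)
open import Data.Integer.Divisibility.Signed
open import Data.Integer.Tactic.RingSolver using (solve-∀)
open import Data.Fin as Fin using (Fin; toℕ; fromℕ<)
import Data.Fin.Properties as Fin
open import Data.Product using (_×_; _,_; proj₁; proj₂; ∃; ∃₂; ∃!; ∃-syntax)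
open import Data.Product.Properties using (≡-dec)
open import Data.Sum as Sum using (_⊎_; inj₁; inj₂)
open import Data.Empty using (⊥; ⊥-elim)
open import Data.List using ([]; _∷_; length; filter; cartesianProduct; allFin)
open import Data.List.Properties using (filter-accept; filter-reject; filter-none; filter-≐)
import Data.List.Relation.Unary.All as All
open import Data.List.Relation.Unary.AllPairs using (_∷_)
open import Data.List.Relation.Unary.Any using (here; there)
open import Data.List.Relation.Unary.Unique.Propositional using (Unique)
open import Data.List.Relation.Unary.Unique.Propositional.Properties using (cartesianProduct⁺; allFin⁺)
open import Data.List.Membership.Propositional using (_∈_)
open import Data.List.Membership.Propositional.Properties using (∈-cartesianProduct⁺; ∈-allFin)
open import Function using (_∘_)
open import Relation.Binary using (DecidableEquality; Setoid; IsEquivalence)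
open import Relation.Binary.PropositionalEquality
import Relation.Binary.Reasoning.Setoid
open import Relation.Nullary using (¬_; yes; no; contradiction)
open import Relation.Nullary.Decidable using (_⊎-dec_)
open import Relation.Unary using (Pred; Decidable)

module _ {A : Set} where

  length-filter-⊎ : ∀ {P Q : Pred A 0ℓ} (P? : Decidable P) (Q? : Decidable Q) →
                    (∀ {x} → P x → ¬ Q x) → ∀ xs →
                    length (filter (λ x → P? x ⊎-dec Q? x) xs) ≡ length (filter P? xs) ℕ.+ length (filter Q? xs)
  length-filter-⊎ P? Q? disjoint [] = refl
  length-filter-⊎ P? Q? disjoint (x ∷ xs) with P? x | Q? x
  ... | yes p | yes q = contradiction q (disjoint p)
  ... | yes _ | no _  = cong suc (length-filter-⊎ P? Q? disjoint xs)
  ... | no _  | yes _ = trans (cong suc (length-filter-⊎ P? Q? disjoint xs)) (sym (ℕ.+-suc _ _))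
  ... | no _  | no _  = length-filter-⊎ P? Q? disjoint xs

  module _ (_≟_ : DecidableEquality A) where

    length-filter-≡ : ∀ {a xs} → Unique xs → a ∈ xs → length (filter (_≟ a) xs) ≡ 1
    length-filter-≡ {xs = x ∷ xs} (x∉xs ∷ _) (here refl) =
      trans (cong length (filter-accept (_≟ x) refl))
            (cong (suc ∘ length) (filter-none (_≟ x) (All.map (_∘ sym) x∉xs)))
    length-filter-≡ {xs = x ∷ xs} (x∉xs ∷ u) (there a∈xs) =
      trans (cong length (filter-reject (_≟ _) (λ { refl → All.lookup x∉xs a∈xs refl })))
            (length-filter-≡ u a∈xs)

    length-filter-≡⊎≡ : ∀ {a b xs} → a ≢ b → Unique xs → a ∈ xs → b ∈ xs →
                        length (filter (λ x → (x ≟ a) ⊎-dec (x ≟ b)) xs) ≡ 2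
    length-filter-≡⊎≡ {a} {b} {xs} a≢b u a∈xs b∈xs =
      trans (length-filter-⊎ (_≟ a) (_≟ b) (λ { refl refl → a≢b refl }) xs)
            (cong₂ ℕ._+_ (length-filter-≡ u a∈xs) (length-filter-≡ u b∈xs))

pairCount≡2 : ∀ {n} (L L′ : Array n) x y {a b} → a ≢ b →
              (∀ {i j} → L i j ≡ x × L′ i j ≡ y → (i , j) ≡ a ⊎ (i , j) ≡ b) →
              (∀ {i j} → (i , j) ≡ a ⊎ (i , j) ≡ b → L i j ≡ x × L′ i j ≡ y) →
              pairCount n L L′ x y ≡ 2
pairCount≡2 {n} L L′ x y {a} {b} a≢b sound complete =
  trans (cong length (filter-≐ _ a∨b? (sound , complete) cells))
        (length-filter-≡⊎≡ _≟_ a≢b (cartesianProduct⁺ (allFin⁺ n) (allFin⁺ n)) (∈-cells a) (∈-cells b))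
  where
    _≟_ = ≡-dec Fin._≟_ Fin._≟_
    a∨b? = λ p → (p ≟ a) ⊎-dec (p ≟ b)
    cells = cartesianProduct (allFin n) (allFin n)
    ∈-cells : ∀ p → p ∈ cells
    ∈-cells (i , j) = ∈-cartesianProduct⁺ (∈-allFin i) (∈-allFin j)

injective⇒surjective : ∀ {n} (f : Fin n → Fin n) → (∀ {i j} → f i ≡ f j → i ≡ j) →
                       ∀ y → ∃ λ i → f i ≡ y
injective⇒surjective {suc n} f inj y with Fin.any? (λ i → f i Fin.≟ y)
... | yes hit  = hit
... | no miss = ⊥-elim (collision (Fin.pigeonhole (ℕ.n<1+n n) (λ i → Fin.punchOut (avoids i))))
  where
    avoids : ∀ i → y ≢ f i
    avoids i y≡fi = miss (i , sym y≡fi)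
    collision : (∃₂ λ i j → i Fin.< j × Fin.punchOut (avoids i) ≡ Fin.punchOut (avoids j)) → ⊥
    collision (i , j , i<j , eq) = ℕ.<⇒≢ i<j (cong toℕ (inj (Fin.punchOut-injective (avoids i) (avoids j) eq)))

∃!-of-injective : ∀ {n} (f : Fin n → Fin n) → (∀ {i j} → f i ≡ f j → i ≡ j) →
                  ∀ y → ∃! _≡_ (λ i → f i ≡ y)
∃!-of-injective f inj y with i , fi≡y ← injective⇒surjective f inj y =
  i , fi≡y , λ fj≡y → inj (trans fi≡y (sym fj≡y))

pos-∸ : ∀ {m n} → n ≤ m → + (m ∸ n) ≡ + m - + n
pos-∸ {m} {n} n≤m = sym (trans (ℤ.m-n≡m⊖n m n) (ℤ.⊖-≥ n≤m))

∣∧<⇒≡0 : ∀ {n d} → n ℕ.∣ d → d < n → d ≡ 0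
∣∧<⇒≡0 {d = zero}  _   _   = refl
∣∧<⇒≡0 {d = suc _} n∣d d<n = contradiction n∣d (ℕ.>⇒∤ d<n)

module Congruence (m : ℤ) where

  infix 4 _≈_ _≉_
  -- A record rather than a function so that a and b can be read off from a ≈ b by unification.
  record _≈_ (a b : ℤ) : Set where
    constructor congruent
    field divides-difference : m ∣ a - b

  _≉_ : ℤ → ℤ → Set
  a ≉ b = ¬ a ≈ b

  ≈-reflexive : ∀ {a b} → a ≡ b → a ≈ b
  ≈-reflexive {a} refl = congruent (divides 0ℤ (trans (ℤ.+-inverseʳ a) (sym (ℤ.*-zeroˡ m))))

  ≈-refl : ∀ {a} → a ≈ a
  ≈-refl = ≈-reflexive refl

  ≈-sym : ∀ {a b} → a ≈ b → b ≈ a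
  ≈-sym {a} {b} (congruent m∣a-b) = congruent (subst (m ∣_) (lemma a b) (∣m⇒∣-m m∣a-b))
    where lemma : ∀ a b → - (a - b) ≡ b - a
          lemma = solve-∀

  ≈-trans : ∀ {a b c} → a ≈ b → b ≈ c → a ≈ c
  ≈-trans {a} {b} {c} (congruent m∣a-b) (congruent m∣b-c) =
    congruent (subst (m ∣_) (lemma a b c) (∣m∣n⇒∣m+n m∣a-b m∣b-c))
    where lemma : ∀ a b c → (a - b) + (b - c) ≡ a - c
          lemma = solve-∀

  ≈-isEquivalence : IsEquivalence _≈_
  ≈-isEquivalence = record { refl = ≈-refl ; sym = ≈-sym ; trans = ≈-trans }

  ≈-setoid : Setoid _ _
  ≈-setoid = record { isEquivalence = ≈-isEquivalence }

  module ≈-Reasoning = Relation.Binary.Reasoning.Setoid ≈-setoid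

  +-cong : ∀ {a b c d} → a ≈ b → c ≈ d → a + c ≈ b + d
  +-cong {a} {b} {c} {d} (congruent m∣a-b) (congruent m∣c-d) =
    congruent (subst (m ∣_) (lemma a b c d) (∣m∣n⇒∣m+n m∣a-b m∣c-d))
    where lemma : ∀ a b c d → (a - b) + (c - d) ≡ (a + c) - (b + d)
          lemma = solve-∀

  neg-cong : ∀ {a b} → a ≈ b → - a ≈ - b
  neg-cong {a} {b} (congruent m∣a-b) = congruent (subst (m ∣_) (lemma a b) (∣m⇒∣-m m∣a-b))
    where lemma : ∀ a b → - (a - b) ≡ - a - - b
          lemma = solve-∀

  -‿cong : ∀ {a b c d} → a ≈ b → c ≈ d → a - c ≈ b - d
  -‿cong a≈b c≈d = +-cong a≈b (neg-cong c≈d)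

  *-congˡ : ∀ c {a b} → a ≈ b → c * a ≈ c * b
  *-congˡ c {a} {b} (congruent m∣a-b) = congruent (subst (m ∣_) (lemma c a b) (∣n⇒∣m*n c m∣a-b))
    where lemma : ∀ c a b → c * (a - b) ≡ c * a - c * b
          lemma = solve-∀

  *-congʳ : ∀ c {a b} → a ≈ b → a * c ≈ b * c
  *-congʳ c {a} {b} a≈b = subst₂ _≈_ (ℤ.*-comm c a) (ℤ.*-comm c b) (*-congˡ c a≈b)

  *-cancel-unit : ∀ {u v a b} → v * u ≈ 1ℤ → u * a ≈ u * b → a ≈ b
  *-cancel-unit {u} {v} {a} {b} vu≈1 ua≈ub = begin
    a             ≡⟨ ℤ.*-identityˡ a ⟨
    1ℤ * a        ≈⟨ *-congʳ a (≈-sym vu≈1) ⟩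
    v * u * a     ≡⟨ ℤ.*-assoc v u a ⟩
    v * (u * a)   ≈⟨ *-congˡ v ua≈ub ⟩
    v * (u * b)   ≡⟨ ℤ.*-assoc v u b ⟨
    v * u * b     ≈⟨ *-congʳ b vu≈1 ⟩
    1ℤ * b        ≡⟨ ℤ.*-identityˡ b ⟩
    b             ∎
    where open ≈-Reasoning

  +-cancelˡ : ∀ c {a b} → c + a ≈ c + b → a ≈ b
  +-cancelˡ c {a} {b} c+a≈c+b = subst₂ _≈_ (lemma c a) (lemma c b) (+-cong (≈-refl { - c}) c+a≈c+b)
    where lemma : ∀ c a → - c + (c + a) ≡ a
          lemma = solve-∀

  +-cancelʳ : ∀ c {a b} → a + c ≈ b + c → a ≈ b
  +-cancelʳ c {a} {b} a+c≈b+c = +-cancelˡ c (subst₂ _≈_ (ℤ.+-comm a c) (ℤ.+-comm b c) a+c≈b+c)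

  neg-injective : ∀ {a b} → - a ≈ - b → a ≈ b
  neg-injective {a} {b} -a≈-b = subst₂ _≈_ (ℤ.neg-involutive a) (ℤ.neg-involutive b) (neg-cong -a≈-b)

  -‿cancelˡ : ∀ c {a b} → c - a ≈ c - b → a ≈ b
  -‿cancelˡ c {a} {b} c-a≈c-b = neg-injective (+-cancelˡ c c-a≈c-b)

  ≈⇒-≈0 : ∀ {a b} → a ≈ b → a - b ≈ 0ℤ
  ≈⇒-≈0 {a} {b} a≈b = subst (a - b ≈_) (ℤ.+-inverseʳ b) (-‿cong a≈b (≈-refl {b}))

  modulus≈0 : m ≈ 0ℤ
  modulus≈0 = congruent (divides 1ℤ (trans (ℤ.+-identityʳ m) (sym (ℤ.*-identityˡ m))))

data Parity : ℕ → Set where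
  even : ∀ i → Parity (i ℕ.* 2)
  odd  : ∀ i → Parity (suc (i ℕ.* 2))

parity : ∀ r → Parity r
parity zero          = even 0
parity (suc zero)    = odd 0
parity (suc (suc r)) with parity r
... | even i = even (suc i)
... | odd i  = odd (suc i)

lowerVal-even : ∀ a b d i → lowerVal a b d (i ℕ.* 2) ≡ a ℕ.+ i ℕ.* d
lowerVal-even a b d i = trans (lowerVal-%2≡0 {i ℕ.* 2} (m*n%n≡0 i 2)) (cong (λ j → a ℕ.+ j ℕ.* d) (m*n/n≡m i 2))
  where
    lowerVal-%2≡0 : ∀ {r} → r ℕ.% 2 ≡ 0 → lowerVal a b d r ≡ a ℕ.+ r ℕ./ 2 ℕ.* d
    lowerVal-%2≡0 {r} r%2≡0 with r ℕ.% 2 ℕ.≟ 0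
    ... | yes _    = refl
    ... | no r%2≢0 = contradiction r%2≡0 r%2≢0

lowerVal-odd : ∀ a b d i → lowerVal a b d (suc (i ℕ.* 2)) ≡ b ℕ.+ i ℕ.* d
lowerVal-odd a b d i = trans (lowerVal-%2≡1 {suc (i ℕ.* 2)} ([m+kn]%n≡m%n 1 i 2))
  (cong (λ j → b ℕ.+ j ℕ.* d) (trans (+-distrib-/-∣ʳ 1 {d = 2} (ℕ.divides-refl i)) (m*n/n≡m i 2)))
  where
    lowerVal-%2≡1 : ∀ {r} → r ℕ.% 2 ≡ 1 → lowerVal a b d r ≡ b ℕ.+ r ℕ./ 2 ℕ.* d
    lowerVal-%2≡1 {r} r%2≡1 with r ℕ.% 2 ℕ.≟ 0
    ... | yes r%2≡0 = contradiction (trans (sym r%2≡1) r%2≡0) λ ()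
    ... | no _      = refl

module CyclicSquares (k : ℕ) where

  N M : ℕ
  N = ord k
  M = 24 ℕ.* k ℕ.+ 7

  K : ℤ
  K = + k

  M*2≡N : M ℕ.* 2 ≡ N
  M*2≡N = lemma k
    where lemma : ∀ k → (24 ℕ.* k ℕ.+ 7) ℕ.* 2 ≡ 14 ℕ.+ 48 ℕ.* k
          lemma = ℕ-solve-∀

  N≡M+M : N ≡ M ℕ.+ M
  N≡M+M = lemma k
    where lemma : ∀ k → 14 ℕ.+ 48 ℕ.* k ≡ (24 ℕ.* k ℕ.+ 7) ℕ.+ (24 ℕ.* k ℕ.+ 7)
          lemma = ℕ-solve-∀

  M<N : M < N
  M<N = subst (M <_) (sym N≡M+M) (ℕ.m<m+n M (ℕ.<-≤-trans (s≤s z≤n) (ℕ.m≤n+m 7 (24 ℕ.* k))))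

  open Congruence (+ N) public

  open ≈-Reasoning

  +N : + N ≡ + 14 + + 48 * K
  +N = trans (ℤ.pos-+ 14 (48 ℕ.* k)) (cong (_+_ (+ 14)) (ℤ.pos-* 48 k))

  -- N is written as a polynomial in k, so that the ring solver can supply the equation.
  ≈-by-quotient : ∀ {a b} q → a - b ≡ q * (+ 14 + + 48 * K) → a ≈ b
  ≈-by-quotient q eq = congruent (divides q (trans eq (cong (q *_) (sym +N))))

  pos-affine : ∀ a b → + (a ℕ.* k ℕ.+ b) ≡ + a * K + + b
  pos-affine a b = trans (ℤ.pos-+ (a ℕ.* k) b) (cong (_+ + b) (ℤ.pos-* a k))

  private
    ≈⇒≥ : ∀ {x y} → x ≤ y → y < N → + x ≈ + y → y ≤ x
    ≈⇒≥ {x} {y} x≤y y<N (congruent N∣x-y) =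
      ℕ.m∸n≡0⇒m≤n (∣∧<⇒≡0 N∣y∸x (ℕ.≤-<-trans (ℕ.m∸n≤m y x) y<N))
      where N∣y∸x : N ℕ.∣ y ∸ x
            N∣y∸x = subst (N ℕ.∣_) (trans (cong ℤ.∣_∣ (ℤ.m-n≡m⊖n x y)) (ℤ.∣⊖∣-≤ x≤y)) (∣⇒∣ᵤ N∣x-y)

  ≈⇒≡ : ∀ {x y} → x < N → y < N → + x ≈ + y → x ≡ y
  ≈⇒≡ {x} {y} x<N y<N x≈y with ℕ.≤-total x y
  ... | inj₁ x≤y = ℕ.≤-antisym x≤y (≈⇒≥ x≤y y<N x≈y)
  ... | inj₂ y≤x = ℕ.≤-antisym (≈⇒≥ y≤x x<N (≈-sym x≈y)) y≤x

  ≈⇒≡-Fin : ∀ {x y : Fin N} → + toℕ x ≈ + toℕ y → x ≡ y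
  ≈⇒≡-Fin {x} {y} = Fin.toℕ-injective ∘ ≈⇒≡ (Fin.toℕ<n x) (Fin.toℕ<n y)

  %ℕ-≈ : ∀ a → + (a ℤ.%ℕ N) ≈ a
  %ℕ-≈ a = congruent (divides (- (a ℤ./ℕ N)) (trans (cong (_-_ (+ (a ℤ.%ℕ N))) (a≡a%ℕn+[a/ℕn]*n a N))
                                                    (lemma (+ (a ℤ.%ℕ N)) (a ℤ./ℕ N) (+ N))))
    where lemma : ∀ r d n → r - (r + d * n) ≡ - d * n
          lemma = solve-∀

  toℕ≡⇒≡fromℕ< : ∀ {i : Fin N} {n} (n<N : n < N) → toℕ i ≡ n → i ≡ fromℕ< n<N
  toℕ≡⇒≡fromℕ< n<N eq = Fin.toℕ-injective (trans eq (sym (Fin.toℕ-fromℕ< n<N)))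

  ≢⇒-≉0 : ∀ {x y : Fin N} → x ≢ y → + toℕ y - + toℕ x ≉ 0ℤ
  ≢⇒-≉0 {x} {y} x≢y y-x≈0 =
    x≢y (sym (≈⇒≡-Fin (+-cancelʳ (- + toℕ x) (≈-trans y-x≈0 (≈-reflexive (sym (ℤ.+-inverseʳ (+ toℕ x))))))))

  residue : ℤ → Fin N
  residue a = fromℕ< (n%ℕd<d a N)

  residue-≈ : ∀ a → + toℕ (residue a) ≈ a
  residue-≈ a = subst (_≈ a) (cong +_ (sym (Fin.toℕ-fromℕ< (n%ℕd<d a N)))) (%ℕ-≈ a)

  residue-injective : ∀ {a b} → residue a ≡ residue b → a ≈ b
  residue-injective {a} {b} eq = ≈-trans (≈-sym (residue-≈ a)) (subst (λ r → + toℕ r ≈ b) (sym eq) (residue-≈ b))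

  cyclicSquare-≈ : ∀ c r j → + toℕ (cyclicSquare k c r j) ≈ + c (toℕ r) + + toℕ j
  cyclicSquare-≈ c r j = subst₂ _≈_ (cong +_ (sym (Fin.toℕ-fromℕ< (m%n<n n N)))) (ℤ.pos-+ (c (toℕ r)) (toℕ j)) (%ℕ-≈ (+ n))
    where n = c (toℕ r) ℕ.+ toℕ j

  row-injective : ∀ c r {j j′} → cyclicSquare k c r j ≡ cyclicSquare k c r j′ → j ≡ j′
  row-injective c r {j} {j′} eq = ≈⇒≡-Fin (+-cancelˡ (+ c (toℕ r)) (begin
    + c (toℕ r) + + toℕ j         ≈⟨ cyclicSquare-≈ c r j ⟨
    + toℕ (cyclicSquare k c r j)  ≡⟨ cong (+_ ∘ toℕ) eq ⟩
    + toℕ (cyclicSquare k c r j′) ≈⟨ cyclicSquare-≈ c r j′ ⟩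
    + c (toℕ r) + + toℕ j′        ∎))

  column-injective : ∀ c → (∀ {r r′} → + c (toℕ r) ≈ + c (toℕ r′) → r ≡ r′) →
                     ∀ j {r r′} → cyclicSquare k c r j ≡ cyclicSquare k c r′ j → r ≡ r′
  column-injective c c-injective j {r} {r′} eq = c-injective (+-cancelʳ (+ toℕ j) (begin
    + c (toℕ r) + + toℕ j         ≈⟨ cyclicSquare-≈ c r j ⟨
    + toℕ (cyclicSquare k c r j)  ≡⟨ cong (+_ ∘ toℕ) eq ⟩
    + toℕ (cyclicSquare k c r′ j) ≈⟨ cyclicSquare-≈ c r′ j ⟩
    + c (toℕ r′) + + toℕ j        ∎))

  cyclicSquare-latin : ∀ c → (∀ {r r′} → + c (toℕ r) ≈ + c (toℕ r′) → r ≡ r′) →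
                       IsLatinSquare N (cyclicSquare k c)
  cyclicSquare-latin c c-injective =
    (λ r → ∃!-of-injective (cyclicSquare k c r) (row-injective c r)) ,
    (λ j → ∃!-of-injective (λ r → cyclicSquare k c r j) (column-injective c c-injective j))

  shiftHalf-≈ : ∀ x → + toℕ (shiftHalf N x) ≈ + toℕ x + + M
  shiftHalf-≈ x = begin
    + toℕ (shiftHalf N x)       ≡⟨ cong +_ (Fin.toℕ-fromℕ< (m%n<n (toℕ x ℕ.+ N ℕ./ 2) N)) ⟩
    + ((toℕ x ℕ.+ N ℕ./ 2) ℕ.% N) ≈⟨ %ℕ-≈ (+ (toℕ x ℕ.+ N ℕ./ 2)) ⟩
    + (toℕ x ℕ.+ N ℕ./ 2)        ≡⟨ ℤ.pos-+ (toℕ x) (N ℕ./ 2) ⟩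
    + toℕ x + + (N ℕ./ 2)        ≡⟨ cong (λ h → + toℕ x + + h) N/2≡M ⟩
    + toℕ x + + M                ∎
    where N/2≡M : N ℕ./ 2 ≡ M
          N/2≡M = trans (cong (ℕ._/ 2) (sym M*2≡N)) (m*n/n≡m M 2)

  record DifferenceCondition (d : Fin N → ℤ) : Set where
    field
      r₀ r₁       : Fin N
      r₀≢r₁       : r₀ ≢ r₁
      d[r₀]≈M     : d r₀ ≈ + M
      d[r₁]≈M     : d r₁ ≈ + M
      d≈M⇒r₀⊎r₁   : ∀ {i} → d i ≈ + M → i ≡ r₀ ⊎ i ≡ r₁
      d≉0         : ∀ {i} → d i ≉ 0ℤ
      d-injective : ∀ {i j} → d i ≈ d j → i ≡ j ⊎ d i ≈ + M

  rowDifference : (ℕ → ℕ) → (ℕ → ℕ) → ℕ → ℤ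
  rowDifference cα cβ r = + cβ r - + cα r

  module _ (cα cβ : ℕ → ℕ) (cond : DifferenceCondition (rowDifference cα cβ ∘ toℕ)) where

    open DifferenceCondition cond

    private
      L L′ : Array N
      L  = cyclicSquare k cα
      L′ = cyclicSquare k cβ

      d : Fin N → ℤ
      d = rowDifference cα cβ ∘ toℕ

      -- Replacing d r₁ by 0 turns d into a bijection onto the residues.
      d′ : Fin N → ℤ
      d′ i with i Fin.≟ r₁
      ... | yes _ = 0ℤ
      ... | no _  = d i

      ≈M⇒≡r₀ : ∀ {i} → i ≢ r₁ → d i ≈ + M → i ≡ r₀
      ≈M⇒≡r₀ {i} i≢r₁ di≈M = not-r₁ (d≈M⇒r₀⊎r₁ {i} di≈M)
        where not-r₁ : i ≡ r₀ ⊎ i ≡ r₁ → i ≡ r₀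
              not-r₁ (inj₁ i≡r₀) = i≡r₀
              not-r₁ (inj₂ i≡r₁) = contradiction i≡r₁ i≢r₁

      d′-injective : ∀ {i j} → d′ i ≈ d′ j → i ≡ j
      d′-injective {i} {j} d′i≈d′j with i Fin.≟ r₁ | j Fin.≟ r₁
      ... | yes i≡r₁ | yes j≡r₁ = trans i≡r₁ (sym j≡r₁)
      ... | yes _    | no _     = contradiction (≈-sym d′i≈d′j) d≉0
      ... | no _     | yes _    = contradiction d′i≈d′j d≉0
      ... | no i≢r₁  | no j≢r₁  = collapse (d-injective {i} {j} d′i≈d′j)
        where collapse : i ≡ j ⊎ d i ≈ + M → i ≡ j
              collapse (inj₁ i≡j)  = i≡j
              collapse (inj₂ di≈M) =
                trans (≈M⇒≡r₀ i≢r₁ di≈M) (sym (≈M⇒≡r₀ j≢r₁ (≈-trans (≈-sym d′i≈d′j) di≈M)))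

      e-injective : ∀ {i j} → residue (d′ i) ≡ residue (d′ j) → i ≡ j
      e-injective {i} {j} eq = d′-injective (residue-injective {d′ i} {d′ j} eq)

      d′≈⇒d≈ : ∀ {i a} → a ≉ 0ℤ → d′ i ≈ a → d i ≈ a
      d′≈⇒d≈ {i} a≉0 d′i≈a with i Fin.≟ r₁
      ... | yes _ = contradiction (≈-sym d′i≈a) a≉0
      ... | no _  = d′i≈a

    d-surjective : ∀ a → a ≉ 0ℤ → ∃ λ i → d i ≈ a
    d-surjective a a≉0 = i , d′≈⇒d≈ {i} a≉0 (residue-injective {d′ i} {a} eq)
      where
        i : Fin N
        i = proj₁ (injective⇒surjective (λ i → residue (d′ i)) e-injective (residue a))
        eq : residue (d′ i) ≡ residue a
        eq = proj₂ (injective⇒surjective (λ i → residue (d′ i)) e-injective (residue a))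

    L′-≈ : ∀ i j → + toℕ (L′ i j) ≈ + toℕ (L i j) + d i
    L′-≈ i j = begin
      + toℕ (L′ i j)                                     ≈⟨ cyclicSquare-≈ cβ i j ⟩
      + cβ (toℕ i) + + toℕ j                             ≡⟨ lemma (+ cα (toℕ i)) (+ cβ (toℕ i)) (+ toℕ j) ⟩
      (+ cα (toℕ i) + + toℕ j) + d i                     ≈⟨ +-cong (≈-sym (cyclicSquare-≈ cα i j)) (≈-refl {d i}) ⟩
      + toℕ (L i j) + d i                                ∎
      where lemma : ∀ a b j → b + j ≡ (a + j) + (b - a)
            lemma = solve-∀

    L′≡⇒d≈ : ∀ {i j x y} → L i j ≡ x → L′ i j ≡ y → d i ≈ + toℕ y - + toℕ x
    L′≡⇒d≈ {i} {j} refl refl = ≈-sym (+-cancelˡ (+ toℕ (L i j)) (begin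
      + toℕ (L i j) + (+ toℕ (L′ i j) - + toℕ (L i j)) ≡⟨ lemma (+ toℕ (L i j)) (+ toℕ (L′ i j)) ⟩
      + toℕ (L′ i j)                                   ≈⟨ L′-≈ i j ⟩
      + toℕ (L i j) + d i                              ∎))
      where lemma : ∀ a b → a + (b - a) ≡ b
            lemma = solve-∀

    d≈⇒L′≡ : ∀ {i j x y} → L i j ≡ x → d i ≈ + toℕ y - + toℕ x → L′ i j ≡ y
    d≈⇒L′≡ {i} {j} {x} {y} refl di≈y-x = ≈⇒≡-Fin (begin
      + toℕ (L′ i j)                            ≈⟨ L′-≈ i j ⟩
      + toℕ (L i j) + d i                       ≈⟨ +-cong (≈-refl {+ toℕ (L i j)}) di≈y-x ⟩
      + toℕ (L i j) + (+ toℕ y - + toℕ (L i j)) ≡⟨ lemma (+ toℕ (L i j)) (+ toℕ y) ⟩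
      + toℕ y                                   ∎)
      where lemma : ∀ a b → a + (b - a) ≡ b
            lemma = solve-∀

    column : Fin N → Fin N → Fin N
    column i x = proj₁ (injective⇒surjective (L i) (row-injective cα i) x)

    L-column : ∀ i x → L i (column i x) ≡ x
    L-column i x = proj₂ (injective⇒surjective (L i) (row-injective cα i) x)

    all-pairs-occur : ∀ x y → x ≢ y → ∃[ i ] ∃[ j ] (L i j ≡ x × L′ i j ≡ y)
    all-pairs-occur x y x≢y = occur (d-surjective (+ toℕ y - + toℕ x) (≢⇒-≉0 x≢y))
      where occur : ∃ (λ i → d i ≈ + toℕ y - + toℕ x) → ∃[ i ] ∃[ j ] (L i j ≡ x × L′ i j ≡ y)
            occur (i , di≈y-x) = i , column i x , L-column i x , d≈⇒L′≡ (L-column i x) di≈y-x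

    shiftHalf-pairs : ∀ x → pairCount N L L′ x (shiftHalf N x) ≡ 2
    shiftHalf-pairs x = pairCount≡2 L L′ x (shiftHalf N x) p₀≢p₁ sound complete
      where
        p₀ p₁ : Fin N × Fin N
        p₀ = r₀ , column r₀ x
        p₁ = r₁ , column r₁ x
        p₀≢p₁ : p₀ ≢ p₁
        p₀≢p₁ = r₀≢r₁ ∘ cong proj₁
        shift≈M : + toℕ (shiftHalf N x) - + toℕ x ≈ + M
        shift≈M = ≈-trans (-‿cong (shiftHalf-≈ x) (≈-refl {+ toℕ x})) (≈-reflexive (lemma (+ toℕ x) (+ M)))
          where lemma : ∀ a b → a + b - a ≡ b
                lemma = solve-∀
        sound : ∀ {i j} → L i j ≡ x × L′ i j ≡ shiftHalf N x → (i , j) ≡ p₀ ⊎ (i , j) ≡ p₁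
        sound {i} {j} (Lij≡x , L′ij≡) = Sum.map at at (d≈M⇒r₀⊎r₁ (≈-trans (L′≡⇒d≈ Lij≡x L′ij≡) shift≈M))
          where at : ∀ {r} → i ≡ r → (i , j) ≡ (r , column r x)
                at refl = cong (i ,_) (row-injective cα i (trans Lij≡x (sym (L-column i x))))
        at-row : ∀ r → d r ≈ + M → L r (column r x) ≡ x × L′ r (column r x) ≡ shiftHalf N x
        at-row r dr≈M = L-column r x , d≈⇒L′≡ (L-column r x) (≈-trans dr≈M (≈-sym shift≈M))
        complete : ∀ {i j} → (i , j) ≡ p₀ ⊎ (i , j) ≡ p₁ → L i j ≡ x × L′ i j ≡ shiftHalf N x
        complete (inj₁ refl) = at-row r₀ d[r₀]≈M
        complete (inj₂ refl) = at-row r₁ d[r₁]≈M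

    nearlyOrthogonal : NearlyOrthogonal N L L′
    nearlyOrthogonal = all-pairs-occur , shiftHalf-pairs

  -M≈M : - + M ≈ + M
  -M≈M = ≈-by-quotient -1ℤ (trans (cong (λ m → - m - m) (pos-affine 24 7)) (lemma K))
    where lemma : ∀ K → - (+ 24 * K + + 7) - (+ 24 * K + + 7) ≡ -1ℤ * (+ 14 + + 48 * K)
          lemma = solve-∀

  mirror : ℕ → ℕ
  mirror r = N ∸ 1 ∸ r

  mirror<N : ∀ r → mirror r < N
  mirror<N r = s≤s (ℕ.m∸n≤m (N ∸ 1) r)

  mirror-involutive : ∀ {r} → r < N → mirror (mirror r) ≡ r
  mirror-involutive r<N = ℕ.m∸[m∸n]≡n (ℕ.<⇒≤pred r<N)

  mirror-≈ : ∀ {r} → r < N → + mirror r ≈ -1ℤ - + r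
  mirror-≈ {r} r<N = begin
    + (N ∸ 1 ∸ r)    ≡⟨ pos-∸ (ℕ.<⇒≤pred r<N) ⟩
    + (N ∸ 1) - + r  ≡⟨ cong (_- + r) (pos-∸ (s≤s z≤n)) ⟩
    + N - 1ℤ - + r   ≈⟨ -‿cong (-‿cong modulus≈0 (≈-refl {1ℤ})) (≈-refl {+ r}) ⟩
    -1ℤ - + r        ∎

  M≤mirror : ∀ {t} → t < M → M ≤ mirror t
  M≤mirror {t} t<M = ℕ.m+n≤o⇒m≤o∸n M (ℕ.<⇒≤pred (subst (M ℕ.+ t <_) (sym N≡M+M) (ℕ.+-monoʳ-< M t<M)))

  mirror<M : ∀ {r} → r < N → M ≤ r → mirror r < M
  mirror<M {r} r<N M≤r = ℕ.≰⇒> λ M≤mirror → ℕ.<⇒≱ (ℕ.n<1+n (N ∸ 1))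
    (subst₂ _≤_ (sym N≡M+M) (ℕ.m+[n∸m]≡n (ℕ.<⇒≤pred r<N)) (ℕ.+-mono-≤ M≤r M≤mirror))

  data Half : ℕ → Set where
    low  : ∀ {t} → t < M → Half t
    high : ∀ {t} → t < M → Half (mirror t)

  half : ∀ {r} → r < N → Half r
  half {r} r<N with r ℕ.<? M
  ... | yes r<M = low r<M
  ... | no r≮M  = subst Half (mirror-involutive r<N) (high (mirror<M r<N (ℕ.≮⇒≥ r≮M)))



  Symmetric : (ℕ → ℕ) → Set
  Symmetric c = ∀ {t} → t < M → + c (mirror t) ≈ -1ℤ - + c t

  symmetric-latin : ∀ c → Symmetric c →
                    (∀ {t t′} → t < M → t′ < M → + c t ≈ + c t′ → t ≡ t′) →
                    (∀ {t t′} → t < M → t′ < M → + c t ≉ -1ℤ - + c t′) →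
                    IsLatinSquare N (cyclicSquare k c)
  symmetric-latin c c-sym low-injective low-apart =
    cyclicSquare-latin c (λ {r} {r′} → Fin.toℕ-injective ∘ injective (half (Fin.toℕ<n r)) (half (Fin.toℕ<n r′)))
    where
      injective : ∀ {r r′} → Half r → Half r′ → + c r ≈ + c r′ → r ≡ r′
      injective (low t<M)  (low t′<M)  ct≈ct′ = low-injective t<M t′<M ct≈ct′
      injective (low t<M)  (high t′<M) ct≈ct′ = contradiction (≈-trans ct≈ct′ (c-sym t′<M)) (low-apart t<M t′<M)
      injective (high t<M) (low t′<M)  ct≈ct′ = contradiction (≈-trans (≈-sym ct≈ct′) (c-sym t<M)) (low-apart t′<M t<M)
      injective (high t<M) (high t′<M) ct≈ct′ = cong mirror (low-injective t<M t′<M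
        (-‿cancelˡ -1ℤ (≈-trans (≈-sym (c-sym t<M)) (≈-trans ct≈ct′ (c-sym t′<M)))))

  difference-antisymmetric : ∀ cα cβ → Symmetric cα → Symmetric cβ →
                             ∀ {t} → t < M → rowDifference cα cβ (mirror t) ≈ - rowDifference cα cβ t
  difference-antisymmetric cα cβ α-sym β-sym {t} t<M = begin
    + cβ (mirror t) - + cα (mirror t)            ≈⟨ -‿cong (β-sym t<M) (α-sym t<M) ⟩
    (-1ℤ - + cβ t) - (-1ℤ - + cα t)              ≡⟨ lemma (+ cα t) (+ cβ t) ⟩
    - (+ cβ t - + cα t)                          ∎
    where lemma : ∀ a b → (-1ℤ - b) - (-1ℤ - a) ≡ - (b - a)
          lemma = solve-∀

  record LowHalfCondition (D : ℕ → ℤ) : Set where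
    field
      t₀          : ℕ
      t₀<M        : t₀ < M
      D[t₀]≈M     : D t₀ ≈ + M
      D-injective : ∀ {t t′} → t < M → t′ < M → D t ≈ D t′ → t ≡ t′
      D-antipodal : ∀ {t t′} → t < M → t′ < M → D t ≈ - D t′ → t ≡ t₀
      D≉0         : ∀ {t} → t < M → D t ≉ 0ℤ

  lowHalf⇒differenceCondition : ∀ {D} → (∀ {t} → t < M → D (mirror t) ≈ - D t) →
                                LowHalfCondition D → DifferenceCondition (D ∘ toℕ)
  lowHalf⇒differenceCondition {D} D-antisym cond = record
    { r₀          = fromℕ< t₀<N
    ; r₁          = fromℕ< (mirror<N t₀)
    ; r₀≢r₁       = λ eq → ℕ.<⇒≢ (ℕ.<-≤-trans t₀<M (M≤mirror t₀<M))
                             (trans (sym (Fin.toℕ-fromℕ< t₀<N)) (trans (cong toℕ eq) (Fin.toℕ-fromℕ< (mirror<N t₀))))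
    ; d[r₀]≈M     = subst (λ r → D r ≈ + M) (sym (Fin.toℕ-fromℕ< t₀<N)) D[t₀]≈M
    ; d[r₁]≈M     = subst (λ r → D r ≈ + M) (sym (Fin.toℕ-fromℕ< (mirror<N t₀))) D[mirror-t₀]≈M
    ; d≈M⇒r₀⊎r₁   = λ {i} → Sum.map (toℕ≡⇒≡fromℕ< t₀<N) (toℕ≡⇒≡fromℕ< (mirror<N t₀))
                               ∘ D≈M⇒ (half (Fin.toℕ<n i))
    ; d≉0         = λ {i} → D≉0′ (half (Fin.toℕ<n i))
    ; d-injective = λ {i} {j} → Sum.map₁ Fin.toℕ-injective ∘ D-injective′ (half (Fin.toℕ<n i)) (half (Fin.toℕ<n j))
    }
    where
      open LowHalfCondition cond

      t₀<N : t₀ < N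
      t₀<N = ℕ.<-trans t₀<M M<N

      D[mirror-t₀]≈M : D (mirror t₀) ≈ + M
      D[mirror-t₀]≈M = ≈-trans (D-antisym t₀<M) (≈-trans (neg-cong D[t₀]≈M) -M≈M)

      D≈M⇒ : ∀ {r} → Half r → D r ≈ + M → r ≡ t₀ ⊎ r ≡ mirror t₀
      D≈M⇒ (low t<M)  Dt≈M = inj₁ (D-injective t<M t₀<M (≈-trans Dt≈M (≈-sym D[t₀]≈M)))
      D≈M⇒ (high {t} t<M) Dt≈M = inj₂ (cong mirror (D-injective t<M t₀<M (neg-injective (begin
        - D t             ≈⟨ D-antisym t<M ⟨
        D (mirror t)      ≈⟨ Dt≈M ⟩
        + M               ≈⟨ -M≈M ⟨
        - + M             ≈⟨ neg-cong D[t₀]≈M ⟨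
        - D t₀            ∎))))

      D≉0′ : ∀ {r} → Half r → D r ≉ 0ℤ
      D≉0′ (low t<M)  = D≉0 t<M
      D≉0′ (high t<M) Dt≈0 = D≉0 t<M (neg-injective (≈-trans (≈-sym (D-antisym t<M)) Dt≈0))

      D-injective′ : ∀ {r r′} → Half r → Half r′ → D r ≈ D r′ → r ≡ r′ ⊎ D r ≈ + M
      D-injective′ (low t<M)  (low t′<M)  Dr≈Dr′ = inj₁ (D-injective t<M t′<M Dr≈Dr′)
      D-injective′ (low t<M)  (high t′<M) Dr≈Dr′ =
        inj₂ (subst (λ t → D t ≈ + M) (sym (D-antipodal t<M t′<M (≈-trans Dr≈Dr′ (D-antisym t′<M)))) D[t₀]≈M)
      D-injective′ (high t<M) (low t′<M)  Dr≈Dr′ =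
        inj₂ (≈-trans Dr≈Dr′ (subst (λ t → D t ≈ + M) (sym (D-antipodal t′<M t<M (≈-trans (≈-sym Dr≈Dr′) (D-antisym t<M)))) D[t₀]≈M))
      D-injective′ (high t<M) (high t′<M) Dr≈Dr′ =
        inj₁ (cong mirror (D-injective t<M t′<M (neg-injective (≈-trans (≈-sym (D-antisym t<M)) (≈-trans Dr≈Dr′ (D-antisym t′<M))))))

  symmetric-nearlyOrthogonal : ∀ cα cβ → Symmetric cα → Symmetric cβ → LowHalfCondition (rowDifference cα cβ) →
                               NearlyOrthogonal N (cyclicSquare k cα) (cyclicSquare k cβ)
  symmetric-nearlyOrthogonal cα cβ α-sym β-sym =
    nearlyOrthogonal cα cβ ∘ lowHalf⇒differenceCondition (difference-antisymmetric cα cβ α-sym β-sym)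

  scaled⇒lowHalfCondition : ∀ {D} (w w⁻¹ : ℤ) (f : ℕ → ℕ) → w⁻¹ * w ≈ 1ℤ → w * + M ≈ + M →
                            (∀ {t} → t < M → D t ≈ w * + f t) →
                            (∀ {t} → t < M → 1 ≤ f t × f t ≤ M) →
                            (∀ {t t′} → t < M → t′ < M → f t ≡ f t′ → t ≡ t′) →
                            ∀ {t₀} → t₀ < M → f t₀ ≡ M → LowHalfCondition D
  scaled⇒lowHalfCondition {D} w w⁻¹ f w-unit wM≈M D≈wf f-range f-injective {t₀} t₀<M ft₀≡M = record
    { t₀          = t₀
    ; t₀<M        = t₀<M
    ; D[t₀]≈M     = ≈-trans (D≈wf t₀<M) (subst (λ m → w * + m ≈ + M) (sym ft₀≡M) wM≈M)
    ; D-injective = λ t<M t′<M Dt≈Dt′ → f-injective t<M t′<M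
                      (≈⇒≡ (f<N t<M) (f<N t′<M) (cancel-w (≈-trans (≈-sym (D≈wf t<M)) (≈-trans Dt≈Dt′ (D≈wf t′<M)))))
    ; D-antipodal = λ {t} {t′} t<M t′<M Dt≈-Dt′ → f-injective t<M t₀<M (trans (f≡M t<M t′<M (cancel-w (begin
                      w * + f t        ≈⟨ D≈wf t<M ⟨
                      D t              ≈⟨ Dt≈-Dt′ ⟩
                      - D t′           ≈⟨ neg-cong (D≈wf t′<M) ⟩
                      - (w * + f t′)   ≡⟨ ℤ.neg-distribʳ-* w (+ f t′) ⟩
                      w * - + f t′     ∎))) (sym ft₀≡M))
    ; D≉0         = λ {t} t<M Dt≈0 → ℕ.<⇒≢ (proj₁ (f-range t<M)) (sym (≈⇒≡ (f<N t<M) (s≤s z≤n)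
                      (cancel-w (≈-trans (≈-sym (D≈wf t<M)) (≈-trans Dt≈0 (≈-reflexive (sym (ℤ.*-zeroʳ w))))))))
    }
    where
      cancel-w : ∀ {a b} → w * a ≈ w * b → a ≈ b
      cancel-w {a} {b} = *-cancel-unit {w} {w⁻¹} {a} {b} w-unit

      f<N : ∀ {t} → t < M → f t < N
      f<N t<M = ℕ.≤-<-trans (proj₂ (f-range t<M)) M<N

      -- f t ≡ -f t′ in ℤ_N forces f t + f t′ = N = 2M, hence f t = f t′ = M.
      f≡M : ∀ {t t′} → t < M → t′ < M → + f t ≈ - + f t′ → f t ≡ M
      f≡M {t} {t′} t<M t′<M ft≈-ft′ = ℕ.≤-antisym (proj₂ (f-range t<M)) (subst (M ≤_) (sym ft≡N-ft′) M≤N-ft′)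
        where
          N-ft′<N : N ∸ f t′ < N
          N-ft′<N = ℕ.∸-monoʳ-< (proj₁ (f-range t′<M)) (ℕ.<⇒≤ (f<N t′<M))
          ft≡N-ft′ : f t ≡ N ∸ f t′
          ft≡N-ft′ = ≈⇒≡ (f<N t<M) N-ft′<N (begin
            + f t              ≈⟨ ft≈-ft′ ⟩
            - + f t′           ≡⟨ ℤ.+-identityˡ (- + f t′) ⟨
            0ℤ - + f t′        ≈⟨ -‿cong modulus≈0 (≈-refl {+ f t′}) ⟨
            + N - + f t′       ≡⟨ pos-∸ (ℕ.<⇒≤ (f<N t′<M)) ⟨
            + (N ∸ f t′)       ∎)
          M≤N-ft′ : M ≤ N ∸ f t′
          M≤N-ft′ = subst (_≤ N ∸ f t′) (trans (cong (_∸ M) N≡M+M) (ℕ.m+n∸n≡m M M)) (ℕ.∸-monoʳ-≤ N (proj₂ (f-range t′<M)))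

module TheSquares (k : ℕ) where

  open CyclicSquares k
  open ≈-Reasoning

  q : ℕ
  q = 12 ℕ.* k ℕ.+ 3

  M≡1+q*2 : M ≡ suc (q ℕ.* 2)
  M≡1+q*2 = lemma k
    where lemma : ∀ k → 24 ℕ.* k ℕ.+ 7 ≡ suc ((12 ℕ.* k ℕ.+ 3) ℕ.* 2)
          lemma = ℕ-solve-∀

  even-index : ∀ {i} → i ℕ.* 2 < M → i ≤ q
  even-index {i} lt = ℕ.*-cancelʳ-≤ i q 2 (ℕ.≤-pred (subst (i ℕ.* 2 <_) M≡1+q*2 lt))

  odd-index : ∀ {i} → suc (i ℕ.* 2) < M → i < q
  odd-index {i} lt = ℕ.*-cancelʳ-< 2 i q (ℕ.≤-pred (subst (suc (i ℕ.* 2) <_) M≡1+q*2 lt))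

  by-parity : ∀ (P : ℕ → Set) →
              (∀ {i} → i ℕ.* 2 < M → P (i ℕ.* 2)) → (∀ {i} → suc (i ℕ.* 2) < M → P (suc (i ℕ.* 2))) →
              ∀ {t} → t < M → P t
  by-parity P on-even on-odd {t} = go (parity t)
    where go : ∀ {t} → Parity t → t < M → P t
          go (even i) = on-even {i}
          go (odd i)  = on-odd {i}

  interleave : ℕ → ℕ → ℕ → ℕ
  interleave a b = lowerVal a b 1

  interleave-even : ∀ a b i → interleave a b (i ℕ.* 2) ≡ a ℕ.+ i
  interleave-even a b i = trans (lowerVal-even a b 1 i) (cong (a ℕ.+_) (ℕ.*-identityʳ i))

  interleave-odd : ∀ a b i → interleave a b (suc (i ℕ.* 2)) ≡ b ℕ.+ i
  interleave-odd a b i = trans (lowerVal-odd a b 1 i) (cong (b ℕ.+_) (ℕ.*-identityʳ i))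

  interleave-injective : ∀ {a b} → (∀ {i j} → i ≤ q → j < q → a ℕ.+ i ≢ b ℕ.+ j) →
                         ∀ {t t′} → t < M → t′ < M → interleave a b t ≡ interleave a b t′ → t ≡ t′
  interleave-injective {a} {b} apart {t} {t′} = go (parity t) (parity t′)
    where
      go : ∀ {t t′} → Parity t → Parity t′ → t < M → t′ < M → interleave a b t ≡ interleave a b t′ → t ≡ t′
      go (even i) (even j) _ _ eq =
        cong (ℕ._* 2) (ℕ.+-cancelˡ-≡ a i j (trans (sym (interleave-even a b i)) (trans eq (interleave-even a b j))))
      go (odd i)  (odd j)  _ _ eq =
        cong (suc ∘ (ℕ._* 2)) (ℕ.+-cancelˡ-≡ b i j (trans (sym (interleave-odd a b i)) (trans eq (interleave-odd a b j))))
      go (even i) (odd j)  lt lt′ eq =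
        contradiction (trans (sym (interleave-even a b i)) (trans eq (interleave-odd a b j))) (apart (even-index lt) (odd-index lt′))
      go (odd i)  (even j) lt lt′ eq =
        contradiction (trans (sym (interleave-even a b j)) (trans (sym eq) (interleave-odd a b i))) (apart (even-index lt′) (odd-index lt))

  interleave<M : ∀ {a b} → (∀ {i} → i ≤ q → a ℕ.+ i < M) → (∀ {j} → j < q → b ℕ.+ j < M) →
                 ∀ {t} → t < M → interleave a b t < M
  interleave<M {a} {b} even<M odd<M = by-parity (λ t → interleave a b t < M)
    (λ {i} lt → subst (_< M) (sym (interleave-even a b i)) (even<M (even-index lt)))
    (λ {i} lt → subst (_< M) (sym (interleave-odd a b i)) (odd<M (odd-index lt)))

  cGen-low : ∀ {a b d t} → t < M → cGen k a b d t ≡ lowerVal a b d t ℕ.% N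
  cGen-low {a} {b} {d} {t} t<M with t ℕ.<? 24 ℕ.* k ℕ.+ 7
  ... | yes _   = refl
  ... | no t≮M = contradiction t<M t≮M

  cGen-high : ∀ {a b d t} → t < M → cGen k a b d (mirror t) ≡ mirror (cGen k a b d t)
  cGen-high {a} {b} {d} {t} t<M with mirror t ℕ.<? 24 ℕ.* k ℕ.+ 7
  ... | yes mt<M = contradiction (M≤mirror t<M) (ℕ.<⇒≱ mt<M)
  ... | no _     = cong mirror (trans (cong (λ r → lowerVal a b d r ℕ.% N) (mirror-involutive (ℕ.<-trans t<M M<N)))
                                      (sym (cGen-low t<M)))

  cGen-symmetric : ∀ {a b d} → Symmetric (cGen k a b d)
  cGen-symmetric {a} {b} {d} {t} t<M =
    subst (_≈ -1ℤ - + cGen k a b d t) (cong +_ (sym (cGen-high t<M))) (mirror-≈ cGen<N)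
    where cGen<N : cGen k a b d t < N
          cGen<N = subst (_< N) (sym (cGen-low t<M)) (m%n<n (lowerVal a b d t) N)

  c₁-symmetric : Symmetric (c₁ k)
  c₁-symmetric t<M = mirror-≈ (ℕ.<-trans t<M M<N)

  cGen-≈ : ∀ {a b d t} → t < M → + cGen k a b d t ≈ + lowerVal a b d t
  cGen-≈ {a} {b} {d} {t} t<M = subst (_≈ + lowerVal a b d t) (cong +_ (sym (cGen-low t<M))) (%ℕ-≈ (+ lowerVal a b d t))

  cGen-even : ∀ a₁ a₀ b d₁ d₀ {i} → i ℕ.* 2 < M →
              + cGen k (a₁ ℕ.* k ℕ.+ a₀) b (d₁ ℕ.* k ℕ.+ d₀) (i ℕ.* 2) ≈ (+ a₁ * K + + a₀) + + i * (+ d₁ * K + + d₀)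
  cGen-even a₁ a₀ b d₁ d₀ {i} lt = begin
    + cGen k a b d (i ℕ.* 2)            ≈⟨ cGen-≈ lt ⟩
    + lowerVal a b d (i ℕ.* 2)          ≡⟨ cong +_ (lowerVal-even a b d i) ⟩
    + (a ℕ.+ i ℕ.* d)                   ≡⟨ ℤ.pos-+ a (i ℕ.* d) ⟩
    + a + + (i ℕ.* d)                   ≡⟨ cong₂ _+_ (pos-affine a₁ a₀) (ℤ.pos-* i d) ⟩
    (+ a₁ * K + + a₀) + + i * + d       ≡⟨ cong (λ x → (+ a₁ * K + + a₀) + + i * x) (pos-affine d₁ d₀) ⟩
    (+ a₁ * K + + a₀) + + i * (+ d₁ * K + + d₀) ∎
    where a = a₁ ℕ.* k ℕ.+ a₀
          d = d₁ ℕ.* k ℕ.+ d₀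

  cGen-odd : ∀ a b₁ b₀ d₁ d₀ {i} → suc (i ℕ.* 2) < M →
             + cGen k a (b₁ ℕ.* k ℕ.+ b₀) (d₁ ℕ.* k ℕ.+ d₀) (suc (i ℕ.* 2)) ≈ (+ b₁ * K + + b₀) + + i * (+ d₁ * K + + d₀)
  cGen-odd a b₁ b₀ d₁ d₀ {i} lt = begin
    + cGen k a b d (suc (i ℕ.* 2))      ≈⟨ cGen-≈ lt ⟩
    + lowerVal a b d (suc (i ℕ.* 2))    ≡⟨ cong +_ (lowerVal-odd a b d i) ⟩
    + (b ℕ.+ i ℕ.* d)                   ≡⟨ ℤ.pos-+ b (i ℕ.* d) ⟩
    + b + + (i ℕ.* d)                   ≡⟨ cong₂ _+_ (pos-affine b₁ b₀) (ℤ.pos-* i d) ⟩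
    (+ b₁ * K + + b₀) + + i * + d       ≡⟨ cong (λ x → (+ b₁ * K + + b₀) + + i * x) (pos-affine d₁ d₀) ⟩
    (+ b₁ * K + + b₀) + + i * (+ d₁ * K + + d₀) ∎
    where b = b₁ ℕ.* k ℕ.+ b₀
          d = d₁ ℕ.* k ℕ.+ d₀

  c₂-even : ∀ {i} → i ℕ.* 2 < M → + c₂ k (i ℕ.* 2) ≈ (+ 6 * K + + 1) + + i * (+ 12 * K + + 4)
  c₂-even {i} = cGen-even 6 1 _ 12 4 {i}

  c₂-odd : ∀ {i} → suc (i ℕ.* 2) < M → + c₂ k (suc (i ℕ.* 2)) ≈ (+ 12 * K + + 3) + + i * (+ 12 * K + + 4)
  c₂-odd {i} = cGen-odd _ 12 3 12 4 {i}

  c₃-even : ∀ {i} → i ℕ.* 2 < M → + c₃ k (i ℕ.* 2) ≈ (+ 6 * K + + 2) + + i * (+ 12 * K + + 5)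
  c₃-even {i} = cGen-even 6 2 _ 12 5 {i}

  c₃-odd : ∀ {i} → suc (i ℕ.* 2) < M → + c₃ k (suc (i ℕ.* 2)) ≈ (+ 24 * K + + 8) + + i * (+ 12 * K + + 5)
  c₃-odd {i} = cGen-odd _ 24 8 12 5 {i}

  pos-even : ∀ i → + (i ℕ.* 2) ≡ + i * + 2
  pos-even i = ℤ.pos-* i 2

  pos-odd : ∀ i → + suc (i ℕ.* 2) ≡ 1ℤ + + i * + 2
  pos-odd i = trans (ℤ.pos-+ 1 (i ℕ.* 2)) (cong (_+_ 1ℤ) (ℤ.pos-* i 2))

  odd≉0 : ∀ a → + 2 * a + 1ℤ ≉ 0ℤ
  odd≉0 a (congruent N∣2a+1) = contradiction (ℕ.∣1⇒≡1 (∣⇒∣ᵤ 2∣1)) λ ()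
    where
      2∣N : + 2 ∣ + N
      2∣N = ∣-trans (divides (+ 7 + + 24 * K) (lemma K)) (∣-reflexive (sym +N))
        where lemma : ∀ K → + 14 + + 48 * K ≡ (+ 7 + + 24 * K) * + 2
              lemma = solve-∀
      2∣1 : + 2 ∣ 1ℤ
      2∣1 = ∣m+n∣m⇒∣n (subst (+ 2 ∣_) (ℤ.+-identityʳ (+ 2 * a + 1ℤ)) (∣-trans 2∣N N∣2a+1)) (∣m⇒∣m*n a ∣-refl)

  u : ℤ
  u = + 6 * K + + 1

  c₂-low : ∀ {t} → t < M → + c₂ k t ≈ u + + t * (u + 1ℤ)
  c₂-low = by-parity (λ t → + c₂ k t ≈ u + + t * (u + 1ℤ))
    (λ {i} lt → begin
      + c₂ k (i ℕ.* 2)                           ≈⟨ c₂-even {i} lt ⟩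
      (+ 6 * K + + 1) + + i * (+ 12 * K + + 4)   ≡⟨ even-case K (+ i) ⟩
      u + (+ i * + 2) * (u + 1ℤ)                  ≡⟨ cong (λ t → u + t * (u + 1ℤ)) (pos-even i) ⟨
      u + + (i ℕ.* 2) * (u + 1ℤ)                  ∎)
    (λ {i} lt → begin
      + c₂ k (suc (i ℕ.* 2))                     ≈⟨ c₂-odd {i} lt ⟩
      (+ 12 * K + + 3) + + i * (+ 12 * K + + 4)  ≡⟨ odd-case K (+ i) ⟩
      u + (1ℤ + + i * + 2) * (u + 1ℤ)             ≡⟨ cong (λ t → u + t * (u + 1ℤ)) (pos-odd i) ⟨
      u + + suc (i ℕ.* 2) * (u + 1ℤ)              ∎)
    where
      even-case : ∀ K i → (+ 6 * K + + 1) + i * (+ 12 * K + + 4) ≡ (+ 6 * K + + 1) + (i * + 2) * ((+ 6 * K + + 1) + 1ℤ)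
      even-case = solve-∀
      odd-case : ∀ K i → (+ 12 * K + + 3) + i * (+ 12 * K + + 4) ≡ (+ 6 * K + + 1) + (1ℤ + i * + 2) * ((+ 6 * K + + 1) + 1ℤ)
      odd-case = solve-∀

  c₂-low-injective : ∀ {t t′} → t < M → t′ < M → + c₂ k t ≈ + c₂ k t′ → t ≡ t′
  c₂-low-injective {t} {t′} t<M t′<M c₂t≈c₂t′ = ℕ.*-cancelʳ-≡ t t′ 2 (≈⇒≡ (double<N t<M) (double<N t′<M) (begin
    + (t ℕ.* 2)                ≡⟨ pos-even t ⟩
    + t * + 2                  ≈⟨ *-congˡ (+ t) 2≈8[u+1] ⟩
    + t * (+ 8 * (u + 1ℤ))     ≡⟨ swap (+ t) ⟩
    + 8 * (+ t * (u + 1ℤ))     ≈⟨ *-congˡ (+ 8) t[u+1]≈t′[u+1] ⟩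
    + 8 * (+ t′ * (u + 1ℤ))    ≡⟨ swap (+ t′) ⟨
    + t′ * (+ 8 * (u + 1ℤ))    ≈⟨ *-congˡ (+ t′) 2≈8[u+1] ⟨
    + t′ * + 2                 ≡⟨ pos-even t′ ⟨
    + (t′ ℕ.* 2)               ∎))
    where
      double<N : ∀ {t} → t < M → t ℕ.* 2 < N
      double<N {t} t<M = subst (t ℕ.* 2 <_) M*2≡N (ℕ.*-monoˡ-< 2 t<M)
      -- u + 1 = 6k + 2 is not a unit, but 8(u + 1) = N + 2.
      2≈8[u+1] : + 2 ≈ + 8 * (u + 1ℤ)
      2≈8[u+1] = ≈-by-quotient -1ℤ (lemma K)
        where lemma : ∀ K → + 2 - + 8 * ((+ 6 * K + + 1) + 1ℤ) ≡ -1ℤ * (+ 14 + + 48 * K)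
              lemma = solve-∀
      swap : ∀ t → t * (+ 8 * (u + 1ℤ)) ≡ + 8 * (t * (u + 1ℤ))
      swap t = lemma t u
        where lemma : ∀ t u → t * (+ 8 * (u + 1ℤ)) ≡ + 8 * (t * (u + 1ℤ))
              lemma = solve-∀
      t[u+1]≈t′[u+1] : + t * (u + 1ℤ) ≈ + t′ * (u + 1ℤ)
      t[u+1]≈t′[u+1] = +-cancelˡ u (≈-trans (≈-sym (c₂-low t<M)) (≈-trans c₂t≈c₂t′ (c₂-low t′<M)))

  c₂-low-apart : ∀ {t t′} → t < M → t′ < M → + c₂ k t ≉ -1ℤ - + c₂ k t′
  c₂-low-apart {t} {t′} t<M t′<M c₂t≈ = odd≉0 (u + (+ t + + t′) * (+ 3 * K + + 1)) (begin
    + 2 * (u + (+ t + + t′) * (+ 3 * K + + 1)) + 1ℤ        ≡⟨ lemma K (+ t) (+ t′) ⟩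
    (u + + t * (u + 1ℤ)) - (-1ℤ - (u + + t′ * (u + 1ℤ)))   ≈⟨ -‿cong (c₂-low t<M) (-‿cong (≈-refl { -1ℤ}) (c₂-low t′<M)) ⟨
    + c₂ k t - (-1ℤ - + c₂ k t′)                           ≈⟨ ≈⇒-≈0 c₂t≈ ⟩
    0ℤ                                                     ∎)
    where lemma : ∀ K t t′ → + 2 * ((+ 6 * K + + 1) + (t + t′) * (+ 3 * K + + 1)) + 1ℤ ≡
                             ((+ 6 * K + + 1) + t * ((+ 6 * K + + 1) + 1ℤ)) - (-1ℤ - ((+ 6 * K + + 1) + t′ * ((+ 6 * K + + 1) + 1ℤ)))
          lemma = solve-∀

  M≡1+q+q : M ≡ suc (q ℕ.+ q)
  M≡1+q+q = lemma k
    where lemma : ∀ k → 24 ℕ.* k ℕ.+ 7 ≡ suc ((12 ℕ.* k ℕ.+ 3) ℕ.+ (12 ℕ.* k ℕ.+ 3))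
          lemma = ℕ-solve-∀

  q<M : q < M
  q<M = subst (q <_) (sym M≡1+q+q) (s≤s (ℕ.m≤m+n q q))

  -- c₃(t) = 6k + 2 + σ(t)(12k + 5)  and  c₃(t) − t = M + τ(t)(12k + 3)  on the lower half.
  σ τ : ℕ → ℕ
  σ = interleave 0 (suc q)
  τ = interleave q 0

  σ<M : ∀ {t} → t < M → σ t < M
  σ<M = interleave<M (λ i≤q → ℕ.≤-<-trans i≤q q<M)
                     (λ {j} j<q → subst (suc q ℕ.+ j <_) (sym M≡1+q+q) (s≤s (ℕ.+-monoʳ-< q j<q)))

  σ-injective : ∀ {t t′} → t < M → t′ < M → σ t ≡ σ t′ → t ≡ t′
  σ-injective = interleave-injective (λ {i} {j} i≤q _ → ℕ.<⇒≢ (s≤s (ℕ.≤-trans i≤q (ℕ.m≤m+n q j))))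

  τ<M : ∀ {t} → t < M → τ t < M
  τ<M = interleave<M (λ {i} i≤q → subst (q ℕ.+ i <_) (sym M≡1+q+q) (s≤s (ℕ.+-monoʳ-≤ q i≤q)))
                     (λ j<q → ℕ.<-trans j<q q<M)

  τ-injective : ∀ {t t′} → t < M → t′ < M → τ t ≡ τ t′ → t ≡ t′
  τ-injective = interleave-injective (λ {i} {j} _ j<q eq → ℕ.<⇒≢ (ℕ.<-≤-trans j<q (ℕ.m≤m+n q i)) (sym eq))

  +σ-odd : ∀ i → + σ (suc (i ℕ.* 2)) ≡ (1ℤ + (+ 12 * K + + 3)) + + i
  +σ-odd i = trans (cong +_ (interleave-odd 0 (suc q) i))
                   (trans (ℤ.pos-+ (suc q) i) (cong (λ x → (1ℤ + x) + + i) (pos-affine 12 3)))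

  +τ-even : ∀ i → + τ (i ℕ.* 2) ≡ (+ 12 * K + + 3) + + i
  +τ-even i = trans (cong +_ (interleave-even q 0 i)) (trans (ℤ.pos-+ q i) (cong (_+ + i) (pos-affine 12 3)))

  a s : ℤ
  a = + 6 * K + + 2
  s = + 12 * K + + 5

  c₃-low : ∀ {t} → t < M → + c₃ k t ≈ a + s * + σ t
  c₃-low = by-parity (λ t → + c₃ k t ≈ a + s * + σ t)
    (λ {i} lt → begin
      + c₃ k (i ℕ.* 2)                          ≈⟨ c₃-even {i} lt ⟩
      a + + i * s                               ≡⟨ cong (_+_ a) (ℤ.*-comm (+ i) s) ⟩
      a + s * + i                               ≡⟨ cong (λ x → a + s * + x) (interleave-even 0 (suc q) i) ⟨
      a + s * + σ (i ℕ.* 2)                     ∎)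
    (λ {i} lt → begin
      + c₃ k (suc (i ℕ.* 2))                    ≈⟨ c₃-odd {i} lt ⟩
      (+ 24 * K + + 8) + + i * s                ≈⟨ ≈-by-quotient (- (+ 3 * K + + 1)) (odd-case K (+ i)) ⟩
      a + s * ((1ℤ + (+ 12 * K + + 3)) + + i)   ≡⟨ cong (λ x → a + s * x) (+σ-odd i) ⟨
      a + s * + σ (suc (i ℕ.* 2))               ∎)
    where
      odd-case : ∀ K i → (+ 24 * K + + 8) + i * (+ 12 * K + + 5) - ((+ 6 * K + + 2) + (+ 12 * K + + 5) * ((1ℤ + (+ 12 * K + + 3)) + i))
                         ≡ - (+ 3 * K + + 1) * (+ 14 + + 48 * K)
      odd-case = solve-∀

  s-unit : (+ 8 * K + + 3) * s ≈ 1ℤ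
  s-unit = ≈-by-quotient (+ 2 * K + + 1) (lemma K)
    where lemma : ∀ K → (+ 8 * K + + 3) * (+ 12 * K + + 5) - 1ℤ ≡ (+ 2 * K + + 1) * (+ 14 + + 48 * K)
          lemma = solve-∀

  s-cancel : ∀ {x y} → s * x ≈ s * y → x ≈ y
  s-cancel {x} {y} = *-cancel-unit {s} {+ 8 * K + + 3} {x} {y} s-unit

  c₃-low-injective : ∀ {t t′} → t < M → t′ < M → + c₃ k t ≈ + c₃ k t′ → t ≡ t′
  c₃-low-injective t<M t′<M c₃t≈c₃t′ = σ-injective t<M t′<M (≈⇒≡ (ℕ.<-trans (σ<M t<M) M<N) (ℕ.<-trans (σ<M t′<M) M<N)
    (s-cancel (+-cancelˡ a (≈-trans (≈-sym (c₃-low t<M)) (≈-trans c₃t≈c₃t′ (c₃-low t′<M))))))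

  c₃-low-apart : ∀ {t t′} → t < M → t′ < M → + c₃ k t ≉ -1ℤ - + c₃ k t′
  c₃-low-apart {t} {t′} t<M t′<M c₃t≈ = ℕ.1+n≢0 (≈⇒≡ sum<N (s≤s z≤n) (s-cancel (begin
    s * + suc (σ t ℕ.+ σ t′)                          ≡⟨ cong (s *_) (ℤ.pos-+ 1 (σ t ℕ.+ σ t′)) ⟩
    s * (1ℤ + + (σ t ℕ.+ σ t′))                       ≡⟨ cong (λ x → s * (1ℤ + x)) (ℤ.pos-+ (σ t) (σ t′)) ⟩
    s * (1ℤ + (+ σ t + + σ t′))                       ≡⟨ lemma K (+ σ t) (+ σ t′) ⟩
    (a + s * + σ t) - (-1ℤ - (a + s * + σ t′))        ≈⟨ -‿cong (c₃-low t<M) (-‿cong (≈-refl { -1ℤ}) (c₃-low t′<M)) ⟨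
    + c₃ k t - (-1ℤ - + c₃ k t′)                      ≈⟨ ≈⇒-≈0 c₃t≈ ⟩
    0ℤ                                                ≡⟨ ℤ.*-zeroʳ s ⟨
    s * 0ℤ                                            ∎)))
    where
      sum<N : suc (σ t ℕ.+ σ t′) < N
      sum<N = subst (suc (σ t ℕ.+ σ t′) <_) (sym N≡M+M) (ℕ.+-mono-≤-< (σ<M t<M) (σ<M t′<M))
      -- exact, because 2(6k + 2) + 1 = 12k + 5
      lemma : ∀ K σ σ′ → (+ 12 * K + + 5) * (1ℤ + (σ + σ′)) ≡
                         ((+ 6 * K + + 2) + (+ 12 * K + + 5) * σ) - (-1ℤ - ((+ 6 * K + + 2) + (+ 12 * K + + 5) * σ′))
      lemma = solve-∀

  lowHalf₁₂ : LowHalfCondition (rowDifference (c₁ k) (c₂ k))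
  lowHalf₁₂ = scaled⇒lowHalfCondition u (+ 8 * K + + 1) suc u-unit uM≈M D≈u[t+1] (λ t<M → s≤s z≤n , t<M)
            (λ _ _ → ℕ.suc-injective) t₀<M (sym (ℕ.+-suc (24 ℕ.* k) 6))
    where
      u-unit : (+ 8 * K + + 1) * u ≈ 1ℤ
      u-unit = ≈-by-quotient K (lemma K)
        where lemma : ∀ K → (+ 8 * K + + 1) * (+ 6 * K + + 1) - 1ℤ ≡ K * (+ 14 + + 48 * K)
              lemma = solve-∀
      uM≈M : u * + M ≈ + M
      uM≈M = ≈-by-quotient (+ 3 * K) (trans (cong (λ m → u * m - m) (pos-affine 24 7)) (lemma K))
        where lemma : ∀ K → (+ 6 * K + + 1) * (+ 24 * K + + 7) - (+ 24 * K + + 7) ≡ (+ 3 * K) * (+ 14 + + 48 * K)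
              lemma = solve-∀
      D≈u[t+1] : ∀ {t} → t < M → + c₂ k t - + t ≈ u * + suc t
      D≈u[t+1] {t} t<M = begin
        + c₂ k t - + t                  ≈⟨ -‿cong (c₂-low t<M) (≈-refl {+ t}) ⟩
        (u + + t * (u + 1ℤ)) - + t      ≡⟨ lemma u (+ t) ⟩
        u * (1ℤ + + t)                  ≡⟨ cong (u *_) (ℤ.pos-+ 1 t) ⟨
        u * + suc t                     ∎
        where lemma : ∀ u t → (u + t * (u + 1ℤ)) - t ≡ u * (1ℤ + t)
              lemma = solve-∀
      t₀<M : 24 ℕ.* k ℕ.+ 6 < M
      t₀<M = subst (24 ℕ.* k ℕ.+ 6 <_) (sym (ℕ.+-suc (24 ℕ.* k) 6)) (ℕ.n<1+n _)

  v : ℤ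
  v = + 12 * K + + 3

  lowHalf₁₃ : LowHalfCondition (rowDifference (c₁ k) (c₃ k))
  lowHalf₁₃ = scaled⇒lowHalfCondition (- v) (- (+ 24 * K + + 5)) (λ t → M ∸ τ t) w-unit wM≈M D≈-v[M-τ]
            (λ {t} t<M → ℕ.m<n⇒0<n∸m (τ<M t<M) , ℕ.m∸n≤m M (τ t))
            (λ t<M t′<M eq → τ-injective t<M t′<M (ℕ.∸-cancelˡ-≡ (ℕ.<⇒≤ (τ<M t<M)) (ℕ.<⇒≤ (τ<M t′<M)) eq))
            1<M (cong (M ∸_) (interleave-odd q 0 0))
    where
      w-unit : - (+ 24 * K + + 5) * - v ≈ 1ℤ
      w-unit = ≈-by-quotient (+ 6 * K + + 1) (lemma K)
        where lemma : ∀ K → - (+ 24 * K + + 5) * - (+ 12 * K + + 3) - 1ℤ ≡ (+ 6 * K + + 1) * (+ 14 + + 48 * K)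
              lemma = solve-∀
      wM≈M : - v * + M ≈ + M
      wM≈M = ≈-by-quotient (- (+ 6 * K + + 2)) (trans (cong (λ m → - v * m - m) (pos-affine 24 7)) (lemma K))
        where lemma : ∀ K → - (+ 12 * K + + 3) * (+ 24 * K + + 7) - (+ 24 * K + + 7) ≡ - (+ 6 * K + + 2) * (+ 14 + + 48 * K)
              lemma = solve-∀
      1<M : 1 < M
      1<M = ℕ.≤-trans (s≤s (s≤s z≤n)) (ℕ.m≤n+m 7 (24 ℕ.* k))
      +[M∸τ] : ∀ {t} → t < M → + (M ∸ τ t) ≡ (+ 24 * K + + 7) - + τ t
      +[M∸τ] {t} t<M = trans (pos-∸ (ℕ.<⇒≤ (τ<M t<M))) (cong (_- + τ t) (pos-affine 24 7))
      D≈-v[M-τ] : ∀ {t} → t < M → + c₃ k t - + t ≈ - v * + (M ∸ τ t)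
      D≈-v[M-τ] = by-parity (λ t → + c₃ k t - + t ≈ - v * + (M ∸ τ t))
        (λ {i} lt → begin
          + c₃ k (i ℕ.* 2) - + (i ℕ.* 2)                ≈⟨ -‿cong (c₃-even {i} lt) (≈-reflexive (pos-even i)) ⟩
          (a + + i * s) - + i * + 2                     ≈⟨ ≈-by-quotient (+ 3 * K + + 1) (even-case K (+ i)) ⟩
          - v * ((+ 24 * K + + 7) - (v + + i))          ≡⟨ cong (λ x → - v * ((+ 24 * K + + 7) - x)) (+τ-even i) ⟨
          - v * ((+ 24 * K + + 7) - + τ (i ℕ.* 2))      ≡⟨ cong (- v *_) (+[M∸τ] lt) ⟨
          - v * + (M ∸ τ (i ℕ.* 2))                     ∎)
        (λ {i} lt → begin
          + c₃ k (suc (i ℕ.* 2)) - + suc (i ℕ.* 2)      ≈⟨ -‿cong (c₃-odd {i} lt) (≈-reflexive (pos-odd i)) ⟩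
          ((+ 24 * K + + 8) + + i * s) - (1ℤ + + i * + 2) ≈⟨ ≈-by-quotient (+ 6 * K + + 2) (odd-case K (+ i)) ⟩
          - v * ((+ 24 * K + + 7) - + i)                ≡⟨ cong (λ x → - v * ((+ 24 * K + + 7) - + x)) (interleave-odd q 0 i) ⟨
          - v * ((+ 24 * K + + 7) - + τ (suc (i ℕ.* 2))) ≡⟨ cong (- v *_) (+[M∸τ] lt) ⟨
          - v * + (M ∸ τ (suc (i ℕ.* 2)))               ∎)
        where
          even-case : ∀ K i → ((+ 6 * K + + 2) + i * (+ 12 * K + + 5)) - i * + 2
                              - - (+ 12 * K + + 3) * ((+ 24 * K + + 7) - ((+ 12 * K + + 3) + i))
                              ≡ (+ 3 * K + + 1) * (+ 14 + + 48 * K)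
          even-case = solve-∀
          odd-case : ∀ K i → ((+ 24 * K + + 8) + i * (+ 12 * K + + 5)) - (1ℤ + i * + 2)
                             - - (+ 12 * K + + 3) * ((+ 24 * K + + 7) - i)
                             ≡ (+ 6 * K + + 2) * (+ 14 + + 48 * K)
          odd-case = solve-∀

  lowHalf₂₃ : LowHalfCondition (rowDifference (c₂ k) (c₃ k))
  lowHalf₂₃ = scaled⇒lowHalfCondition 1ℤ 1ℤ (suc ∘ σ) (≈-refl {1ℤ}) (≈-reflexive (ℤ.*-identityˡ (+ M))) D≈1+σ
            (λ t<M → s≤s z≤n , σ<M t<M) (λ t<M t′<M → σ-injective t<M t′<M ∘ ℕ.suc-injective)
            t₀<M (trans (cong suc (interleave-odd 0 (suc q) (12 ℕ.* k ℕ.+ 2))) (lemma k))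
    where
      t₀ : ℕ
      t₀ = suc ((12 ℕ.* k ℕ.+ 2) ℕ.* 2)
      lemma : ∀ k → suc (suc (12 ℕ.* k ℕ.+ 3) ℕ.+ (12 ℕ.* k ℕ.+ 2)) ≡ 24 ℕ.* k ℕ.+ 7
      lemma = ℕ-solve-∀
      t₀<M : t₀ < M
      t₀<M = subst (t₀ <_) (sym (M≡2+t₀ k)) (ℕ.n≤1+n (suc t₀))
        where M≡2+t₀ : ∀ k → 24 ℕ.* k ℕ.+ 7 ≡ suc (suc (suc ((12 ℕ.* k ℕ.+ 2) ℕ.* 2)))
              M≡2+t₀ = ℕ-solve-∀
      D≈1+σ : ∀ {t} → t < M → + c₃ k t - + c₂ k t ≈ 1ℤ * + suc (σ t)
      D≈1+σ = by-parity (λ t → + c₃ k t - + c₂ k t ≈ 1ℤ * + suc (σ t))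
        (λ {i} lt → begin
          + c₃ k (i ℕ.* 2) - + c₂ k (i ℕ.* 2)          ≈⟨ -‿cong (c₃-even {i} lt) (c₂-even {i} lt) ⟩
          (a + + i * s) - (u + + i * (+ 12 * K + + 4)) ≡⟨ even-case K (+ i) ⟩
          1ℤ * (1ℤ + + i)                              ≡⟨ cong (λ x → 1ℤ * (1ℤ + + x)) (interleave-even 0 (suc q) i) ⟨
          1ℤ * + suc (σ (i ℕ.* 2))                     ∎)
        (λ {i} lt → begin
          + c₃ k (suc (i ℕ.* 2)) - + c₂ k (suc (i ℕ.* 2))              ≈⟨ -‿cong (c₃-odd {i} lt) (c₂-odd {i} lt) ⟩
          ((+ 24 * K + + 8) + + i * s) - (v + + i * (+ 12 * K + + 4))   ≡⟨ odd-case K (+ i) ⟩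
          1ℤ * (1ℤ + ((1ℤ + (+ 12 * K + + 3)) + + i))                   ≡⟨ cong (λ x → 1ℤ * (1ℤ + x)) (+σ-odd i) ⟨
          1ℤ * + suc (σ (suc (i ℕ.* 2)))                                ∎)
        where
          even-case : ∀ K i → ((+ 6 * K + + 2) + i * (+ 12 * K + + 5)) - ((+ 6 * K + + 1) + i * (+ 12 * K + + 4)) ≡ 1ℤ * (1ℤ + i)
          even-case = solve-∀
          odd-case : ∀ K i → ((+ 24 * K + + 8) + i * (+ 12 * K + + 5)) - ((+ 12 * K + + 3) + i * (+ 12 * K + + 4))
                             ≡ 1ℤ * (1ℤ + ((1ℤ + (+ 12 * K + + 3)) + i))
          odd-case = solve-∀

theorem3 : (k : ℕ) →
    IsLatinSquare (ord k) (L₁ k) × IsLatinSquare (ord k) (L₂ k) × IsLatinSquare (ord k) (L₃ k) ×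
    NearlyOrthogonal (ord k) (L₁ k) (L₂ k) × NearlyOrthogonal (ord k) (L₁ k) (L₃ k) ×
    NearlyOrthogonal (ord k) (L₂ k) (L₃ k)
theorem3 k =
  cyclicSquare-latin (c₁ k) ≈⇒≡-Fin ,
  symmetric-latin (c₂ k) cGen-symmetric c₂-low-injective c₂-low-apart ,
  symmetric-latin (c₃ k) cGen-symmetric c₃-low-injective c₃-low-apart ,
  symmetric-nearlyOrthogonal (c₁ k) (c₂ k) c₁-symmetric cGen-symmetric lowHalf₁₂ ,
  symmetric-nearlyOrthogonal (c₁ k) (c₃ k) c₁-symmetric cGen-symmetric lowHalf₁₃ ,
  symmetric-nearlyOrthogonal (c₂ k) (c₃ k) cGen-symmetric cGen-symmetric lowHalf₂₃
  where open CyclicSquares k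
        open TheSquares k
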